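{- Let $\mathbf x\in\operatorname{GL}_2(\mathbb Q)^+$. Then the set of $(\tau_1,\tau_2)\in\mathbb H\times\mathbb H$ such that the plane $\Psi(\tau_1,\tau_2)$ is contained in $\mathbf x^\perp$ is exactly the image of the embedding $\mathbb H\hookrightarrow\mathbb H\times\mathbb H$, $\tau\mapsto(\mathbf x\tau,\tau)$.
   Context: Equip $\operatorname{Mat}_2(\mathbb R)$ with the symmetric bilinear form $Q(X,Y)=\det(X+Y)-\det X-\det Y$ (so $Q(X,X)=2\det X$, signature $(2,2)$); $\mathbf x^\perp$ is taken with respect to $Q$. For $(\tau_1,\tau_2)\in\mathbb H^2$, $\tau_k=x_k+iy_k$, let $\Psi(\tau_1,\tau_2)$ be the negative definite plane spanned by $\begin{pmatrix}y_1&-x_2y_1-x_1y_2\\0&-y_2\end{pmatrix}$ and $\begin{pmatrix}x_1&-x_1x_2+y_1y_2\\1&-x_2\end{pmatrix}$; $\Psi$ identifies $\mathbb H\times\mathbb H$ with the connected component of the space of negative planes containing $\operatorname{span}\{\operatorname{diag}(1,-1),\begin{pmatrix}0&1\\1&0\end{pmatrix}\}$. $\operatorname{GL}_2(\mathbb Q)^+$ acts on $\mathbb H$ by Möbius transformations. -}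

module Defs where

open import Level using (0ℓ)
open import Data.Nat as ℕ using (ℕ; zero; suc)
open import Data.Integer as ℤ using (ℤ; +_; -[1+_])
open import Data.Rational as ℚ using (ℚ)
open import Data.Product using (Σ; ∃; _×_; _,_)
open import Relation.Binary.PropositionalEquality using (_≡_; _≢_)
open import Relation.Nullary using (¬_)
open import Algebra.Structures using (IsCommutativeRing)
open import Relation.Binary.Structures using (IsStrictTotalOrder)

-- The real numbers, axiomatised as a complete ordered field.
-- (agda-stdlib has no reals; every model of this record is isomorphic to ℝ.)
-- Division is a total operation _⁻¹ with the usual law for nonzero elements.

record RealField : Set₁ where
  infixl 6 _+_ _-_
  infixl 7 _*_
  infix 4 _<_ _≤_
  field
    ℝ      : Set
    _+_ _*_ : ℝ → ℝ → ℝ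
    -_     : ℝ → ℝ
    0# 1#  : ℝ
    _⁻¹    : ℝ → ℝ
    _<_    : ℝ → ℝ → Set
    isCommutativeRing : IsCommutativeRing _≡_ _+_ _*_ -_ 0# 1#
    0≢1    : 0# ≢ 1#
    ⁻¹-inverse : ∀ x → x ≢ 0# → x * (x ⁻¹) ≡ 1#
    <-isStrictTotalOrder : IsStrictTotalOrder _≡_ _<_
    +-mono-< : ∀ {x y} z → x < y → x + z < y + z
    *-pos    : ∀ {x y} → 0# < x → 0# < y → 0# < x * y
    sup : (P : ℝ → Set) → (∃ λ a → P a) → (∃ λ b → ∀ a → P a → ¬ (b < a)) →
          ∃ λ s → (∀ a → P a → ¬ (s < a)) × (∀ b → (∀ a → P a → ¬ (b < a)) → ¬ (b < s))

  _-_ : ℝ → ℝ → ℝ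
  x - y = x + (- y)

  _≤_ : ℝ → ℝ → Set
  x ≤ y = ¬ (y < x)

  _/_ : ℝ → ℝ → ℝ
  x / y = x * (y ⁻¹)

  fromℕ : ℕ → ℝ
  fromℕ zero    = 0#
  fromℕ (suc n) = 1# + fromℕ n

  fromℤ : ℤ → ℝ
  fromℤ (+ n)      = fromℕ n
  fromℤ -[1+ n ]   = - (1# + fromℕ n)

  fromℚ : ℚ → ℝ
  fromℚ q = fromℤ (ℚ.numerator q) / fromℕ (ℚ.denominatorℕ q)

record Mat2 (A : Set) : Set where
  constructor mat
  field a b c d : A   -- ( a b ; c d )

module Over (R : RealField) where
  open RealField R

  det : Mat2 ℝ → ℝ
  det (mat a b c d) = a * d - b * c

  _+ᴹ_ : Mat2 ℝ → Mat2 ℝ → Mat2 ℝ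
  mat a b c d +ᴹ mat a' b' c' d' = mat (a + a') (b + b') (c + c') (d + d')

  _·ᴹ_ : ℝ → Mat2 ℝ → Mat2 ℝ
  r ·ᴹ mat a b c d = mat (r * a) (r * b) (r * c) (r * d)

  Q : Mat2 ℝ → Mat2 ℝ → ℝ
  Q X Y = det (X +ᴹ Y) - det X - det Y

  embed : Mat2 ℚ → Mat2 ℝ
  embed (mat a b c d) = mat (fromℚ a) (fromℚ b) (fromℚ c) (fromℚ d)

  record ℍ : Set where
    constructor _+i_⟨_⟩
    field
      re im : ℝ
      im>0 : 0# < im

  _≈ℍ_ : ℍ → ℍ → Set
  τ ≈ℍ σ = (ℍ.re τ ≡ ℍ.re σ) × (ℍ.im τ ≡ ℍ.im σ)

  Ψ₁ Ψ₂ : ℍ → ℍ → Mat2 ℝ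
  Ψ₁ (x₁ +i y₁ ⟨ _ ⟩) (x₂ +i y₂ ⟨ _ ⟩) = mat y₁ (- (x₂ * y₁) - x₁ * y₂) 0# (- y₂)
  Ψ₂ (x₁ +i y₁ ⟨ _ ⟩) (x₂ +i y₂ ⟨ _ ⟩) = mat x₁ (- (x₁ * x₂) + y₁ * y₂) 1# (- x₂)

  _∈Ψ_,_ : Mat2 ℝ → ℍ → ℍ → Set
  M ∈Ψ τ₁ , τ₂ = ∃ λ s → ∃ λ t → M ≡ ((s ·ᴹ Ψ₁ τ₁ τ₂) +ᴹ (t ·ᴹ Ψ₂ τ₁ τ₂))

  _∈⊥_ : Mat2 ℝ → Mat2 ℝ → Set
  M ∈⊥ X = Q X M ≡ 0#

  Ψ⊆⊥ : ℍ → ℍ → Mat2 ℝ → Set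
  Ψ⊆⊥ τ₁ τ₂ X = ∀ M → M ∈Ψ τ₁ , τ₂ → M ∈⊥ X

detℚ : Mat2 ℚ → ℚ
detℚ (mat a b c d) = a ℚ.* d ℚ.- b ℚ.* c

record GL2Q⁺ : Set where
  constructor gl
  field
    mtx  : Mat2 ℚ
    det>0 : ℚ.0ℚ ℚ.< detℚ mtx

module Möbius (R : RealField) where
  open RealField R
  open Over R

  -- (a τ + b)/(c τ + d) for τ = u + i v:
  --   real part  = (a c (u²+v²) + (a d + b c) u + b d) / ((c u + d)² + (c v)²)
  --   imag part  = (a d − b c) v / ((c u + d)² + (c v)²)
  -- (positivity of the imaginary part is a fact, not needed to state x τ = σ
  --  coordinatewise.)
  mobRe mobIm : GL2Q⁺ → ℍ → ℝ
  mobRe (gl (mat a' b' c' d') _) (u +i v ⟨ _ ⟩) =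
    let a = fromℚ a' ; b = fromℚ b' ; c = fromℚ c' ; d = fromℚ d'
        N = (c * u + d) * (c * u + d) + (c * v) * (c * v)
    in (a * c * (u * u + v * v) + (a * d + b * c) * u + b * d) / N
  mobIm (gl (mat a' b' c' d') _) (u +i v ⟨ _ ⟩) =
    let a = fromℚ a' ; b = fromℚ b' ; c = fromℚ c' ; d = fromℚ d'
        N = (c * u + d) * (c * u + d) + (c * v) * (c * v)
    in ((a * d - b * c) * v) / N

  _·τ≈_ : GL2Q⁺ → ℍ × ℍ → Set
  x ·τ≈ (τ , σ) = (mobRe x τ ≡ ℍ.re σ) × (mobIm x τ ≡ ℍ.im σ)

module Submission where

-- Q(X, ·) is the polarised determinant, hence linear, so Ψ(τ₁, τ₂) ⊆ X^⊥ exactly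
-- when Q(X, Ψ₁) and Q(X, Ψ₂) vanish; these two numbers are the imaginary and real
-- parts of (cτ₂ + d) τ₁ − (aτ₂ + b). Since det X > 0 and Im τ₂ > 0 we have
-- cτ₂ + d ≠ 0, so this vanishes iff τ₁ = X τ₂; multiplying by the conjugate of
-- cτ₂ + d turns it into the coordinatewise Möbius formula. The point τ of the
-- statement is then forced to be τ₂.

open import Level using (0ℓ)
open import Data.Nat as ℕ using (zero; suc)
import Data.Nat.Properties as ℕP
open import Data.Integer as ℤ using (ℤ; 0ℤ; 1ℤ; -[1+_]; _⊖_; sign; ∣_∣)
import Data.Integer.Properties as ℤP
open import Data.Sign as Sign using (Sign)
open import Data.Rational as ℚ using (ℚ)
import Data.Rational.Properties as ℚP
open import Data.Maybe as Maybe using (Maybe)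
open import Data.Product using (∃; _×_; _,_)
open import Data.Product.Algebra using (×-comm)
open import Data.Product.Function.NonDependent.Propositional using (_×-⇔_)
open import Data.Empty using (⊥-elim)
open import Function using (id; _∘_)
open import Function.Bundles using (_⇔_; mk⇔)
open import Function.Properties.Inverse using (↔⇒⇔)
open import Function.Properties.Equivalence using (⇔-setoid)
open import Relation.Nullary using (¬_)
open import Relation.Binary.Consequences using (dec⇒weaklyDec)
open import Relation.Binary.PropositionalEquality
open import Relation.Binary.Structures using (IsStrictTotalOrder)
open import Relation.Binary.Definitions using (tri<; tri≈; tri>)
open import Algebra.Bundles using (CommutativeRing)
open import Algebra.Solver.Ring.AlmostCommutativeRing
  using (fromCommutativeRing; _-Raw-AlmostCommutative⟶_)
import Algebra.Properties.Ring as RingProperties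
import Algebra.Properties.AbelianGroup as AbelianGroupProperties
import Algebra.Properties.Group as GroupProperties
import Algebra.Properties.CommutativeSemigroup as CommutativeSemigroupProperties
import Algebra.Properties.Semiring.Mult.TCOptimised as SemiringMult
import Algebra.Solver.Ring as RingSolver
import Relation.Binary.Reasoning.Setoid as SetoidReasoning

open import Defs

module ⇔-Reasoning = SetoidReasoning (⇔-setoid 0ℓ)

≡-congˡ-⇔ : ∀ {A : Set} {x y z : A} → x ≡ y → (x ≡ z ⇔ y ≡ z)
≡-congˡ-⇔ refl = mk⇔ id id

module RealFieldRing (R : RealField) where
  open RealField R

  commutativeRing : CommutativeRing 0ℓ 0ℓ
  commutativeRing = record { isCommutativeRing = isCommutativeRing }

  open CommutativeRing commutativeRing public
    using ( +-comm; +-identityˡ; +-identityʳ; -‿inverseʳ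
          ; *-assoc; *-comm; *-identityʳ; zeroˡ )
  open RingProperties (CommutativeRing.ring commutativeRing) public
    using (-‿distribˡ-*; -‿distribʳ-*; -0#≈0#)
  open GroupProperties (CommutativeRing.+-group commutativeRing) public
    using (⁻¹-involutive; x∙y⁻¹≈ε⇒x≈y)
  open AbelianGroupProperties (CommutativeRing.+-abelianGroup commutativeRing)
    using (⁻¹-∙-comm)
  open CommutativeSemigroupProperties
    (CommutativeRing.+-commutativeSemigroup commutativeRing) using (interchange)
  open SemiringMult (CommutativeRing.semiring commutativeRing)
    using (1+×; ×-homo-+; ×1-homo-*) renaming (_×_ to _×′_)
  open ≡-Reasoning

  signed : Sign → ℝ → ℝ
  signed Sign.+ x = x
  signed Sign.- x = - x

  -- The solver's coefficient map; the optimised _×′_ makes the literals 0 and 1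
  -- evaluate to 0# and 1# definitionally.
  ℤ→ℝ : ℤ → ℝ
  ℤ→ℝ i = signed (sign i) (∣ i ∣ ×′ 1#)

  1+a-[1+b]≡a-b : ∀ a b → (1# + a) - (1# + b) ≡ a - b
  1+a-[1+b]≡a-b a b = begin
    (1# + a) + - (1# + b)      ≡⟨ cong ((1# + a) +_) (⁻¹-∙-comm 1# b) ⟨
    (1# + a) + (- 1# + - b)    ≡⟨ interchange 1# a (- 1#) (- b) ⟩
    (1# + - 1#) + (a + - b)    ≡⟨ cong (_+ (a - b)) (-‿inverseʳ 1#) ⟩
    0# + (a - b)               ≡⟨ +-identityˡ (a - b) ⟩
    a - b                      ∎

  ℤ→ℝ-⊖ : ∀ m n → ℤ→ℝ (m ⊖ n) ≡ m ×′ 1# - n ×′ 1#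
  ℤ→ℝ-⊖ m       zero    = sym (trans (cong (m ×′ 1# +_) -0#≈0#) (+-identityʳ _))
  ℤ→ℝ-⊖ zero    (suc n) = sym (+-identityˡ _)
  ℤ→ℝ-⊖ (suc m) (suc n) = begin
    ℤ→ℝ (suc m ⊖ suc n)              ≡⟨ cong ℤ→ℝ (ℤP.[1+m]⊖[1+n]≡m⊖n m n) ⟩
    ℤ→ℝ (m ⊖ n)                      ≡⟨ ℤ→ℝ-⊖ m n ⟩
    m ×′ 1# - n ×′ 1#                ≡⟨ 1+a-[1+b]≡a-b _ _ ⟨
    (1# + m ×′ 1#) - (1# + n ×′ 1#)  ≡⟨ cong₂ _-_ (1+× m 1#) (1+× n 1#) ⟨
    suc m ×′ 1# - suc n ×′ 1#        ∎

  ℤ→ℝ-+ : ∀ i j → ℤ→ℝ (i ℤ.+ j) ≡ ℤ→ℝ i + ℤ→ℝ j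
  ℤ→ℝ-+ (ℤ.+ m)  (ℤ.+ n)  = ×-homo-+ 1# m n
  ℤ→ℝ-+ (ℤ.+ m)  -[1+ n ] = ℤ→ℝ-⊖ m (suc n)
  ℤ→ℝ-+ -[1+ m ] (ℤ.+ n)  = trans (ℤ→ℝ-⊖ n (suc m)) (+-comm _ _)
  ℤ→ℝ-+ -[1+ m ] -[1+ n ] = begin
    - (suc (suc (m ℕ.+ n)) ×′ 1#)      ≡⟨ cong (λ k → - (suc k ×′ 1#)) (ℕP.+-suc m n) ⟨
    - ((suc m ℕ.+ suc n) ×′ 1#)        ≡⟨ cong -_ (×-homo-+ 1# (suc m) (suc n)) ⟩
    - (suc m ×′ 1# + suc n ×′ 1#)      ≡⟨ ⁻¹-∙-comm _ _ ⟨
    - (suc m ×′ 1#) + - (suc n ×′ 1#)  ∎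

  signed-◃ : ∀ s n → ℤ→ℝ (s ℤ.◃ n) ≡ signed s (n ×′ 1#)
  signed-◃ Sign.+ zero    = refl
  signed-◃ Sign.- zero    = sym -0#≈0#
  signed-◃ Sign.+ (suc n) = refl
  signed-◃ Sign.- (suc n) = refl

  signed-* : ∀ s t x y → signed (s Sign.* t) (x * y) ≡ signed s x * signed t y
  signed-* Sign.+ Sign.+ x y = refl
  signed-* Sign.+ Sign.- x y = -‿distribʳ-* x y
  signed-* Sign.- Sign.+ x y = -‿distribˡ-* x y
  signed-* Sign.- Sign.- x y = begin
    x * y        ≡⟨ ⁻¹-involutive (x * y) ⟨
    - - (x * y)  ≡⟨ cong -_ (-‿distribˡ-* x y) ⟩
    - (- x * y)  ≡⟨ -‿distribʳ-* (- x) y ⟩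
    - x * - y    ∎

  ℤ→ℝ-* : ∀ i j → ℤ→ℝ (i ℤ.* j) ≡ ℤ→ℝ i * ℤ→ℝ j
  ℤ→ℝ-* i j = begin
    ℤ→ℝ (s ℤ.◃ (∣ i ∣ ℕ.* ∣ j ∣))            ≡⟨ signed-◃ s (∣ i ∣ ℕ.* ∣ j ∣) ⟩
    signed s ((∣ i ∣ ℕ.* ∣ j ∣) ×′ 1#)       ≡⟨ cong (signed s) (×1-homo-* ∣ i ∣ ∣ j ∣) ⟩
    signed s ((∣ i ∣ ×′ 1#) * (∣ j ∣ ×′ 1#))  ≡⟨ signed-* (sign i) (sign j) (∣ i ∣ ×′ 1#) (∣ j ∣ ×′ 1#) ⟩
    ℤ→ℝ i * ℤ→ℝ j                            ∎
    where s = sign i Sign.* sign j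

  ℤ→ℝ-neg : ∀ i → ℤ→ℝ (ℤ.- i) ≡ - ℤ→ℝ i
  ℤ→ℝ-neg (ℤ.+ zero)  = sym -0#≈0#
  ℤ→ℝ-neg (ℤ.+ suc n) = refl
  ℤ→ℝ-neg -[1+ n ]    = sym (⁻¹-involutive _)

  ℤ→ℝ-homomorphism : ℤ.+-*-rawRing -Raw-AlmostCommutative⟶ fromCommutativeRing commutativeRing
  ℤ→ℝ-homomorphism = record
    { ⟦_⟧ = ℤ→ℝ ; +-homo = ℤ→ℝ-+ ; *-homo = ℤ→ℝ-* ; -‿homo = ℤ→ℝ-neg
    ; 0-homo = refl ; 1-homo = refl }

  ℤ→ℝ-≟ : ∀ i j → Maybe (ℤ→ℝ i ≡ ℤ→ℝ j)
  ℤ→ℝ-≟ i j = Maybe.map (cong ℤ→ℝ) (dec⇒weaklyDec ℤ._≟_ i j)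

  open RingSolver ℤ.+-*-rawRing (fromCommutativeRing commutativeRing) ℤ→ℝ-homomorphism ℤ→ℝ-≟ public
    using (Polynomial; solve; _:=_; _:+_; _:*_; _:-_; :-_; con)

module RealFieldProperties (R : RealField) where
  open RealField R
  open RealFieldRing R
  open IsStrictTotalOrder <-isStrictTotalOrder using (compare; asym)
  open ≡-Reasoning

  <-irrefl : ∀ {x} → ¬ (x < x)
  <-irrefl = IsStrictTotalOrder.irrefl <-isStrictTotalOrder refl

  <⇒≢ : ∀ {x y} → x < y → x ≢ y
  <⇒≢ x<y refl = <-irrefl x<y

  x<0⇒0<-x : ∀ {x} → x < 0# → 0# < - x
  x<0⇒0<-x {x} x<0 = subst₂ _<_ (-‿inverseʳ x) (+-identityˡ (- x)) (+-mono-< (- x) x<0)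

  -x*-x≡x*x : ∀ x → - x * - x ≡ x * x
  -x*-x≡x*x = solve 1 (λ x → (:- x) :* (:- x) := x :* x) refl

  x≢0⇒0<x*x : ∀ {x} → x ≢ 0# → 0# < x * x
  x≢0⇒0<x*x {x} x≢0 with compare x 0#
  ... | tri< x<0 _ _ = subst (0# <_) (-x*-x≡x*x x) (*-pos (x<0⇒0<-x x<0) (x<0⇒0<-x x<0))
  ... | tri≈ _ x≡0 _ = ⊥-elim (x≢0 x≡0)
  ... | tri> _ _ 0<x = *-pos 0<x 0<x

  0≤x*x : ∀ x → 0# ≤ x * x
  0≤x*x x x*x<0 with compare x 0#
  ... | tri< _ x≢0 _ = asym x*x<0 (x≢0⇒0<x*x x≢0)
  ... | tri≈ _ x≡0 _ = <-irrefl (subst (_< 0#) (trans (cong (_* x) x≡0) (zeroˡ x)) x*x<0)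
  ... | tri> _ x≢0 _ = asym x*x<0 (x≢0⇒0<x*x x≢0)

  0<1 : 0# < 1#
  0<1 = subst (0# <_) (*-identityʳ 1#) (x≢0⇒0<x*x (λ 1≡0 → 0≢1 (sym 1≡0)))

  0<x+y : ∀ {x y} → 0# < x → 0# ≤ y → 0# < x + y
  0<x+y {x} {y} 0<x 0≤y with compare y 0#
  ... | tri< y<0 _ _ = ⊥-elim (0≤y y<0)
  ... | tri≈ _ y≡0 _ = subst (0# <_) (sym (trans (cong (x +_) y≡0) (+-identityʳ x))) 0<x
  ... | tri> _ _ 0<y = IsStrictTotalOrder.trans <-isStrictTotalOrder 0<y
                         (subst (_< x + y) (+-identityˡ y) (+-mono-< y 0<x))

  x*x+y*y≡0⇒x≡0 : ∀ {x y} → x * x + y * y ≡ 0# → x ≡ 0#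
  x*x+y*y≡0⇒x≡0 {x} {y} e with compare x 0#
  ... | tri< _ x≢0 _ = ⊥-elim (<⇒≢ (0<x+y (x≢0⇒0<x*x x≢0) (0≤x*x y)) (sym e))
  ... | tri≈ _ x≡0 _ = x≡0
  ... | tri> _ x≢0 _ = ⊥-elim (<⇒≢ (0<x+y (x≢0⇒0<x*x x≢0) (0≤x*x y)) (sym e))

  0<fromℕ-suc : ∀ n → 0# < fromℕ (suc n)
  0<fromℕ-suc zero    = 0<x+y 0<1 <-irrefl
  0<fromℕ-suc (suc n) = 0<x+y 0<1 (asym (0<fromℕ-suc n))

  x*y/y≡x : ∀ {y} → y ≢ 0# → ∀ x → (x * y) / y ≡ x
  x*y/y≡x {y} y≢0 x = begin
    x * y * y ⁻¹    ≡⟨ *-assoc x y (y ⁻¹) ⟩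
    x * (y * y ⁻¹)  ≡⟨ cong (x *_) (⁻¹-inverse y y≢0) ⟩
    x * 1#          ≡⟨ *-identityʳ x ⟩
    x               ∎

  x/y*y≡x : ∀ {y} → y ≢ 0# → ∀ x → (x / y) * y ≡ x
  x/y*y≡x {y} y≢0 x = begin
    x * y ⁻¹ * y    ≡⟨ *-assoc x (y ⁻¹) y ⟩
    x * (y ⁻¹ * y)  ≡⟨ cong (x *_) (*-comm (y ⁻¹) y) ⟩
    x * (y * y ⁻¹)  ≡⟨ *-assoc x y (y ⁻¹) ⟨
    x * y * y ⁻¹    ≡⟨ x*y/y≡x y≢0 x ⟩
    x               ∎

  x*y≡0⇒x≡0 : ∀ {x y} → y ≢ 0# → x * y ≡ 0# → x ≡ 0#
  x*y≡0⇒x≡0 {x} {y} y≢0 e = begin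
    x              ≡⟨ x*y/y≡x y≢0 x ⟨
    x * y * y ⁻¹   ≡⟨ cong (_* y ⁻¹) e ⟩
    0# * y ⁻¹      ≡⟨ zeroˡ (y ⁻¹) ⟩
    0#             ∎

  x/y≡0⇒x≡0 : ∀ {x y} → y ≢ 0# → x / y ≡ 0# → x ≡ 0#
  x/y≡0⇒x≡0 {x} {y} y≢0 e = begin
    x              ≡⟨ x/y*y≡x y≢0 x ⟨
    (x / y) * y    ≡⟨ cong (_* y) e ⟩
    0# * y         ≡⟨ zeroˡ y ⟩
    0#             ∎

  /≡⇔*-≡0 : ∀ {x y z} → y ≢ 0# → (x / y ≡ z ⇔ z * y - x ≡ 0#)
  /≡⇔*-≡0 {x} {y} {z} y≢0 = mk⇔ to from
    where
    to : x / y ≡ z → z * y - x ≡ 0#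
    to refl = trans (cong (_- x) (x/y*y≡x y≢0 x)) (-‿inverseʳ x)
    from : z * y - x ≡ 0# → x / y ≡ z
    from e = trans (cong (_/ y) (sym (x∙y⁻¹≈ε⇒x≈y (z * y) x e))) (x*y/y≡x y≢0 z)

  fromℤ≡0⇒≡0 : ∀ i → fromℤ i ≡ 0# → i ≡ ℤ.+ 0
  fromℤ≡0⇒≡0 (ℤ.+ zero)  _ = refl
  fromℤ≡0⇒≡0 (ℤ.+ suc n) e = ⊥-elim (<⇒≢ (0<fromℕ-suc n) (sym e))
  fromℤ≡0⇒≡0 -[1+ n ]    e = ⊥-elim (<⇒≢ (0<fromℕ-suc n) (sym (begin
    fromℕ (suc n)          ≡⟨ ⁻¹-involutive (fromℕ (suc n)) ⟨
    - - fromℕ (suc n)      ≡⟨ cong -_ e ⟩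
    - 0#                   ≡⟨ -0#≈0# ⟩
    0#                     ∎)))

  mulConj≡0⇒≡0 : ∀ {α β} → α * α + β * β ≢ 0# → ∀ e₁ e₂ →
    e₁ * α + e₂ * β ≡ 0# → e₂ * α - e₁ * β ≡ 0# → e₁ ≡ 0# × e₂ ≡ 0#
  mulConj≡0⇒≡0 {α} {β} N≢0 e₁ e₂ f₁≡0 f₂≡0 =
      x*y≡0⇒x≡0 N≢0 (begin
        e₁ * (α * α + β * β)                           ≡⟨ e₁-identity α β e₁ e₂ ⟩
        α * (e₁ * α + e₂ * β) - β * (e₂ * α - e₁ * β)  ≡⟨ cong₂ (λ f₁ f₂ → α * f₁ - β * f₂) f₁≡0 f₂≡0 ⟩
        α * 0# - β * 0#                                ≡⟨ solve 2 (λ α β → α :* con 0ℤ :- β :* con 0ℤ := con 0ℤ) refl α β ⟩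
        0#                                             ∎)
    , x*y≡0⇒x≡0 N≢0 (begin
        e₂ * (α * α + β * β)                           ≡⟨ e₂-identity α β e₁ e₂ ⟩
        β * (e₁ * α + e₂ * β) + α * (e₂ * α - e₁ * β)  ≡⟨ cong₂ (λ f₁ f₂ → β * f₁ + α * f₂) f₁≡0 f₂≡0 ⟩
        β * 0# + α * 0#                                ≡⟨ solve 2 (λ α β → β :* con 0ℤ :+ α :* con 0ℤ := con 0ℤ) refl α β ⟩
        0#                                             ∎)
    where
    e₁-identity : ∀ α β e₁ e₂ → e₁ * (α * α + β * β) ≡ α * (e₁ * α + e₂ * β) - β * (e₂ * α - e₁ * β)
    e₁-identity = solve 4 (λ α β e₁ e₂ →
      e₁ :* (α :* α :+ β :* β) := α :* (e₁ :* α :+ e₂ :* β) :- β :* (e₂ :* α :- e₁ :* β)) refl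
    e₂-identity : ∀ α β e₁ e₂ → e₂ * (α * α + β * β) ≡ β * (e₁ * α + e₂ * β) + α * (e₂ * α - e₁ * β)
    e₂-identity = solve 4 (λ α β e₁ e₂ →
      e₂ :* (α :* α :+ β :* β) := β :* (e₁ :* α :+ e₂ :* β) :+ α :* (e₂ :* α :- e₁ :* β)) refl

  ≡0⇒mulConj≡0 : ∀ {α β e₁ e₂} → e₁ ≡ 0# → e₂ ≡ 0# → e₁ * α + e₂ * β ≡ 0# × e₂ * α - e₁ * β ≡ 0#
  ≡0⇒mulConj≡0 {α} {β} refl refl =
      solve 2 (λ α β → con 0ℤ :* α :+ con 0ℤ :* β := con 0ℤ) refl α β
    , solve 2 (λ α β → con 0ℤ :* α :- con 0ℤ :* β := con 0ℤ) refl α β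

  -- (e₁ + i e₂)(α − i β) vanishes iff e₁ + i e₂ does, as α − i β ≠ 0.
  mulConj≡0⇔≡0 : ∀ {α β e₁ e₂} → α * α + β * β ≢ 0# →
    (e₁ * α + e₂ * β ≡ 0# × e₂ * α - e₁ * β ≡ 0#) ⇔ (e₁ ≡ 0# × e₂ ≡ 0#)
  mulConj≡0⇔≡0 {e₁ = e₁} {e₂} N≢0 =
    mk⇔ (λ (f₁≡0 , f₂≡0) → mulConj≡0⇒≡0 N≢0 e₁ e₂ f₁≡0 f₂≡0)
        (λ (e₁≡0 , e₂≡0) → ≡0⇒mulConj≡0 e₁≡0 e₂≡0)

  fromℚ≡0⇒≡0 : ∀ q → fromℚ q ≡ 0# → q ≡ ℚ.0ℚ
  fromℚ≡0⇒≡0 q e = ℚP.↥p≡0⇒p≡0 q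
    (fromℤ≡0⇒≡0 (ℚ.numerator q) (x/y≡0⇒x≡0 (<⇒≢ (0<fromℕ-suc (ℚ.denominator-1 q)) ∘ sym) e))

module PolarisedDeterminant (R : RealField) where
  open RealField R
  open RealFieldRing R
  open Over R
  open ≡-Reasoning

  :det : ∀ {n} → (a b c d : Polynomial n) → Polynomial n
  :det a b c d = a :* d :- b :* c

  :Q : ∀ {n} → (A B C D a b c d : Polynomial n) → Polynomial n
  :Q A B C D a b c d = :det (A :+ a) (B :+ b) (C :+ c) (D :+ d) :- :det A B C D :- :det a b c d

  Q-linearʳ : ∀ X M N s t → Q X ((s ·ᴹ M) +ᴹ (t ·ᴹ N)) ≡ s * Q X M + t * Q X N
  Q-linearʳ (mat A B C D) (mat a b c d) (mat a' b' c' d') s t =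
    solve 14 (λ A B C D a b c d a' b' c' d' s t →
      :Q A B C D (s :* a :+ t :* a') (s :* b :+ t :* b') (s :* c :+ t :* c') (s :* d :+ t :* d')
      := s :* :Q A B C D a b c d :+ t :* :Q A B C D a' b' c' d')
    refl A B C D a b c d a' b' c' d' s t

  span⊆⊥⇔ : ∀ {X M₁ M₂} →
    (∀ M → (∃ λ s → ∃ λ t → M ≡ (s ·ᴹ M₁) +ᴹ (t ·ᴹ M₂)) → M ∈⊥ X) ⇔ (M₁ ∈⊥ X × M₂ ∈⊥ X)
  span⊆⊥⇔ {X} {M₁} {M₂} = mk⇔ to from
    where
    q₁ = Q X M₁
    q₂ = Q X M₂
    to : (∀ M → (∃ λ s → ∃ λ t → M ≡ (s ·ᴹ M₁) +ᴹ (t ·ᴹ M₂)) → M ∈⊥ X) → M₁ ∈⊥ X × M₂ ∈⊥ X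
    to span⊆⊥ = (begin
        q₁                 ≡⟨ solve 2 (λ q₁ q₂ → q₁ := con 1ℤ :* q₁ :+ con 0ℤ :* q₂) refl q₁ q₂ ⟩
        1# * q₁ + 0# * q₂  ≡⟨ Q-linearʳ X M₁ M₂ 1# 0# ⟨
        Q X ((1# ·ᴹ M₁) +ᴹ (0# ·ᴹ M₂)) ≡⟨ span⊆⊥ _ (1# , 0# , refl) ⟩
        0#                 ∎)
      , (begin
        q₂                 ≡⟨ solve 2 (λ q₁ q₂ → q₂ := con 0ℤ :* q₁ :+ con 1ℤ :* q₂) refl q₁ q₂ ⟩
        0# * q₁ + 1# * q₂  ≡⟨ Q-linearʳ X M₁ M₂ 0# 1# ⟨
        Q X ((0# ·ᴹ M₁) +ᴹ (1# ·ᴹ M₂)) ≡⟨ span⊆⊥ _ (0# , 1# , refl) ⟩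
        0#                 ∎)
    from : M₁ ∈⊥ X × M₂ ∈⊥ X → ∀ M → (∃ λ s → ∃ λ t → M ≡ (s ·ᴹ M₁) +ᴹ (t ·ᴹ M₂)) → M ∈⊥ X
    from (q₁≡0 , q₂≡0) _ (s , t , refl) = begin
      Q X ((s ·ᴹ M₁) +ᴹ (t ·ᴹ M₂))  ≡⟨ Q-linearʳ X M₁ M₂ s t ⟩
      s * q₁ + t * q₂               ≡⟨ cong₂ (λ p q → s * p + t * q) q₁≡0 q₂≡0 ⟩
      s * 0# + t * 0#               ≡⟨ solve 2 (λ s t → s :* con 0ℤ :+ t :* con 0ℤ := con 0ℤ) refl s t ⟩
      0#                            ∎

module UpperHalfPlane (R : RealField) where
  open RealField R
  open RealFieldRing R
  open RealFieldProperties R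
  open PolarisedDeterminant R
  open Over R
  open Möbius R
  open ℍ

  -- The automorphy factor cτ + d, and (cτ + d) σ − (aτ + b), split into real
  -- and imaginary parts.
  jRe jIm : Mat2 ℝ → ℍ → ℝ
  jRe (mat _ _ c d) τ = c * re τ + d
  jIm (mat _ _ c _) τ = c * im τ

  defectRe defectIm : Mat2 ℝ → ℍ → ℍ → ℝ
  defectRe X@(mat a b _ _) σ τ = jRe X τ * re σ - jIm X τ * im σ - (a * re τ + b)
  defectIm X@(mat a _ _ _) σ τ = jRe X τ * im σ + jIm X τ * re σ - a * im τ

  Q-Ψ₁ : ∀ X σ τ → Q X (Ψ₁ σ τ) ≡ defectIm X σ τ
  Q-Ψ₁ (mat A B C D) (x +i y ⟨ _ ⟩) (u +i v ⟨ _ ⟩) =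
    solve 8 (λ A B C D x y u v →
      :Q A B C D y (:- (u :* y) :- x :* v) (con 0ℤ) (:- v)
      := (C :* u :+ D) :* y :+ C :* v :* x :- A :* v)
    refl A B C D x y u v

  Q-Ψ₂ : ∀ X σ τ → Q X (Ψ₂ σ τ) ≡ defectRe X σ τ
  Q-Ψ₂ (mat A B C D) (x +i y ⟨ _ ⟩) (u +i v ⟨ _ ⟩) =
    solve 8 (λ A B C D x y u v →
      :Q A B C D x (:- (x :* u) :+ y :* v) (con 1ℤ) (:- u)
      := (C :* u :+ D) :* x :- C :* v :* y :- (A :* u :+ B))
    refl A B C D x y u v

  Ψ⊆⊥⇔defect≡0 : ∀ X σ τ → Ψ⊆⊥ σ τ X ⇔ (defectRe X σ τ ≡ 0# × defectIm X σ τ ≡ 0#)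
  Ψ⊆⊥⇔defect≡0 X σ τ = begin
    Ψ⊆⊥ σ τ X                                          ≈⟨ span⊆⊥⇔ ⟩
    (Q X (Ψ₁ σ τ) ≡ 0# × Q X (Ψ₂ σ τ) ≡ 0#)            ≈⟨ ≡-congˡ-⇔ (Q-Ψ₁ X σ τ) ×-⇔ ≡-congˡ-⇔ (Q-Ψ₂ X σ τ) ⟩
    (defectIm X σ τ ≡ 0# × defectRe X σ τ ≡ 0#)        ≈⟨ ↔⇒⇔ (×-comm _ _) ⟩
    (defectRe X σ τ ≡ 0# × defectIm X σ τ ≡ 0#)        ∎
    where open ⇔-Reasoning

  |j|²≢0 : ∀ g τ → let X = embed (GL2Q⁺.mtx g) in jRe X τ * jRe X τ + jIm X τ * jIm X τ ≢ 0#
  |j|²≢0 (gl (mat a b c d) 0<det) (u +i v ⟨ 0<v ⟩) |j|²≡0 =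
    ℚP.<-irrefl refl (subst (ℚ.0ℚ ℚ.<_) (det≡0 (fromℚ≡0⇒≡0 c C≡0) (fromℚ≡0⇒≡0 d D≡0)) 0<det)
    where
    open ≡-Reasoning
    C = fromℚ c
    D = fromℚ d
    C≡0 : C ≡ 0#
    C≡0 = x*y≡0⇒x≡0 (<⇒≢ 0<v ∘ sym) (x*x+y*y≡0⇒x≡0 (trans (+-comm _ _) |j|²≡0))
    D≡0 : D ≡ 0#
    D≡0 = begin
      D            ≡⟨ +-identityˡ D ⟨
      0# + D       ≡⟨ cong (_+ D) (zeroˡ u) ⟨
      0# * u + D   ≡⟨ cong (λ k → k * u + D) C≡0 ⟨
      C * u + D    ≡⟨ x*x+y*y≡0⇒x≡0 |j|²≡0 ⟩
      0#           ∎
    det≡0 : c ≡ ℚ.0ℚ → d ≡ ℚ.0ℚ → detℚ (mat a b c d) ≡ ℚ.0ℚ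
    det≡0 refl refl rewrite ℚP.*-zeroʳ a | ℚP.*-zeroʳ b = ℚP.+-inverseʳ ℚ.0ℚ

  ·τ≈⇔defect≡0 : ∀ g τ σ → let X = embed (GL2Q⁺.mtx g) in
    g ·τ≈ (τ , σ) ⇔ (defectRe X σ τ ≡ 0# × defectIm X σ τ ≡ 0#)
  ·τ≈⇔defect≡0 g@(gl (mat a b c d) _) τ@(u +i v ⟨ _ ⟩) σ@(x +i y ⟨ _ ⟩) = begin
    g ·τ≈ (τ , σ)                                      ≈⟨ /≡⇔*-≡0 N≢0 ×-⇔ /≡⇔*-≡0 N≢0 ⟩
    (x * N - P ≡ 0# × y * N - I ≡ 0#)                  ≈⟨ ≡-congˡ-⇔ (re-identity A B C D x y u v)
                                                          ×-⇔ ≡-congˡ-⇔ (im-identity A B C D x y u v) ⟩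
    (dRe * α + dIm * β ≡ 0# × dIm * α - dRe * β ≡ 0#)  ≈⟨ mulConj≡0⇔≡0 N≢0 ⟩
    (dRe ≡ 0# × dIm ≡ 0#)                              ∎
    where
    open ⇔-Reasoning
    X = embed (GL2Q⁺.mtx g)
    A = fromℚ a
    B = fromℚ b
    C = fromℚ c
    D = fromℚ d
    α = jRe X τ
    β = jIm X τ
    N = α * α + β * β
    N≢0 : N ≢ 0#
    N≢0 = |j|²≢0 g τ
    P = A * C * (u * u + v * v) + (A * D + B * C) * u + B * D
    I = (A * D - B * C) * v
    dRe = defectRe X σ τ
    dIm = defectIm X σ τ
    -- (cτ + d)‾ ((cτ + d) σ − (aτ + b)) = |cτ + d|² σ − (aτ + b)(cτ + d)‾
    re-identity : ∀ A B C D x y u v →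
      x * ((C * u + D) * (C * u + D) + C * v * (C * v))
        - (A * C * (u * u + v * v) + (A * D + B * C) * u + B * D)
      ≡ ((C * u + D) * x - C * v * y - (A * u + B)) * (C * u + D)
        + ((C * u + D) * y + C * v * x - A * v) * (C * v)
    re-identity = solve 8 (λ A B C D x y u v →
      x :* ((C :* u :+ D) :* (C :* u :+ D) :+ C :* v :* (C :* v))
        :- (A :* C :* (u :* u :+ v :* v) :+ (A :* D :+ B :* C) :* u :+ B :* D)
      := ((C :* u :+ D) :* x :- C :* v :* y :- (A :* u :+ B)) :* (C :* u :+ D)
        :+ ((C :* u :+ D) :* y :+ C :* v :* x :- A :* v) :* (C :* v)) refl
    im-identity : ∀ A B C D x y u v →
      y * ((C * u + D) * (C * u + D) + C * v * (C * v)) - (A * D - B * C) * v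
      ≡ ((C * u + D) * y + C * v * x - A * v) * (C * u + D)
        - ((C * u + D) * x - C * v * y - (A * u + B)) * (C * v)
    im-identity = solve 8 (λ A B C D x y u v →
      y :* ((C :* u :+ D) :* (C :* u :+ D) :+ C :* v :* (C :* v)) :- (A :* D :- B :* C) :* v
      := ((C :* u :+ D) :* y :+ C :* v :* x :- A :* v) :* (C :* u :+ D)
        :- ((C :* u :+ D) :* x :- C :* v :* y :- (A :* u :+ B)) :* (C :* v)) refl

  ·τ≈-resp-≈ℍ : ∀ g σ τ τ' → τ ≈ℍ τ' → g ·τ≈ (τ , σ) → g ·τ≈ (τ' , σ)
  ·τ≈-resp-≈ℍ g σ (u +i v ⟨ _ ⟩) (.u +i .v ⟨ _ ⟩) (refl , refl) g·τ≈σ = g·τ≈σ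

  ∃≈ℍ⇔ : ∀ (P : ℍ → Set) → (∀ τ τ' → τ ≈ℍ τ' → P τ → P τ') → ∀ σ →
    (∃ λ τ → P τ × τ ≈ℍ σ) ⇔ P σ
  ∃≈ℍ⇔ _ P-resp σ = mk⇔ (λ (τ , Pτ , τ≈σ) → P-resp τ σ τ≈σ Pτ) (λ Pσ → σ , Pσ , refl , refl)

mainTheorem8 : (R : RealField) (x : GL2Q⁺) (τ₁ τ₂ : Over.ℍ R) →
    Over.Ψ⊆⊥ R τ₁ τ₂ (Over.embed R (GL2Q⁺.mtx x))
      ⇔ (∃ λ (τ : Over.ℍ R) → Möbius._·τ≈_ R x (τ , τ₁) × Over._≈ℍ_ R τ τ₂)
mainTheorem8 R x τ₁ τ₂ = begin
  Ψ⊆⊥ τ₁ τ₂ X                                        ≈⟨ Ψ⊆⊥⇔defect≡0 X τ₁ τ₂ ⟩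
  (defectRe X τ₁ τ₂ ≡ 0# × defectIm X τ₁ τ₂ ≡ 0#)    ≈⟨ ·τ≈⇔defect≡0 x τ₂ τ₁ ⟨
  x ·τ≈ (τ₂ , τ₁)                                    ≈⟨ ∃≈ℍ⇔ (λ τ → x ·τ≈ (τ , τ₁)) (·τ≈-resp-≈ℍ x τ₁) τ₂ ⟨
  (∃ λ τ → x ·τ≈ (τ , τ₁) × τ ≈ℍ τ₂)                 ∎
  where
  open RealField R
  open Over R
  open Möbius R
  open UpperHalfPlane R
  open ⇔-Reasoning
  X = embed (GL2Q⁺.mtx x)
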